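{- Let $\Sigma$ be a null-faced 4-simplex in Minkowski spacetime $\mathbb{R}^{1,3}$. Then either exactly two of its five tetrahedral hyperfaces are past hyperfaces and three are future hyperfaces, or exactly two are future and three are past. In the case of two past and three future hyperfaces: the two past tetrahedra are of type $(1,3)$ and the three future tetrahedra are of type $(2,2)$; among the ten triangular 2-faces, one is past-past, six are past-future and three are future-future. The time-reversed statements hold in the other case.
   Context: Minkowski spacetime has metric $\eta_{\mu\nu}=\operatorname{diag}(-1,1,1,1)$. A null hyperplane is a hyperplane whose normal vector is null. It divides spacetime into a part lying in its causal future and a part lying in its causal past. A null-faced 4-simplex is a 4-simplex in $\mathbb{R}^{1,3}$ each of whose five tetrahedral hyperfaces lies in a null hyperplane; its 2-faces and edges are then spacelike. A hyperface of a convex 4-polytope is a "past hyperface" if the polytope lies to the future of the null hyperplane containing that hyperface, and a "future hyperface" if the polytope lies to its past. A 2-face, being the intersection of two hyperfaces, is called past-past, past-future or future-future according to the types of those two hyperfaces. For a null tetrahedron (a tetrahedron with spacelike faces lying in a null hyperplane), a face is "past" or "future" according to whether the outgoing direction along the null generators of the hyperplane at that face is past- or future-pointing. The tetrahedron has type $(m,n)$ if it has $m$ past faces and $n$ future faces. -}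

module Defs where

open import Data.Nat using (ℕ; zero; suc)
open import Data.Fin using (Fin; zero; suc; punchIn)
open import Data.List using (List; []; _∷_; allFin)
open import Data.Product using (Σ; ∃; _×_; _,_)
open import Data.Sum using (_⊎_)
open import Relation.Nullary using (¬_)
open import Relation.Binary.PropositionalEquality using (_≡_)
open import Relation.Binary.Structures using (IsStrictTotalOrder)
open import Algebra.Structures using (IsCommutativeRing)

-- The real numbers, axiomatised as a complete ordered field
-- (any two such are isomorphic, so this is "ℝ").

record Reals : Set₁ where
  infixl 6 _+_
  infixl 7 _*_
  infix  4 _<_ _≤_
  field
    Carrier : Set
    _+_ _*_ : Carrier → Carrier → Carrier
    -_      : Carrier → Carrier
    0# 1#   : Carrier
    isCommutativeRing : IsCommutativeRing _≡_ _+_ _*_ -_ 0# 1#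
    0≢1     : ¬ (0# ≡ 1#)
    inverse : ∀ x → ¬ (x ≡ 0#) → ∃ λ y → x * y ≡ 1#
    _<_     : Carrier → Carrier → Set
    isStrictTotalOrder : IsStrictTotalOrder _≡_ _<_
    +-mono-< : ∀ {x y} z → x < y → x + z < y + z
    *-pos    : ∀ {x y} → 0# < x → 0# < y → 0# < x * y

  _≤_ : Carrier → Carrier → Set
  x ≤ y = x < y ⊎ x ≡ y

  _-_ : Carrier → Carrier → Carrier
  x - y = x + (- y)

  UpperBound : (Carrier → Set) → Carrier → Set
  UpperBound P b = ∀ x → P x → x ≤ b

  field
    supremum : (P : Carrier → Set) → ∃ P → ∃ (UpperBound P) →
               ∃ λ s → UpperBound P s × (∀ b → UpperBound P b → s ≤ b)

data Count {A : Set} (P : A → Set) : List A → ℕ → Set where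
  nil  : Count P [] zero
  yes  : ∀ {x xs k} → P x → Count P xs k → Count P (x ∷ xs) (suc k)
  no   : ∀ {x xs k} → ¬ P x → Count P xs k → Count P (x ∷ xs) k

-- the ten 2-faces of a 4-simplex with vertices 0..4: the triangle
-- {v k | k ∉ {i,j}} = intersection of hyperfaces i and j, for i < j.
twoFaces : List (Fin 5 × Fin 5)
twoFaces =
  (f0 , f1) ∷ (f0 , f2) ∷ (f0 , f3) ∷ (f0 , f4) ∷ (f1 , f2) ∷
  (f1 , f3) ∷ (f1 , f4) ∷ (f2 , f3) ∷ (f2 , f4) ∷ (f3 , f4) ∷ []
  where
  f0 f1 f2 f3 f4 : Fin 5
  f0 = zero
  f1 = suc zero
  f2 = suc (suc zero)
  f3 = suc (suc (suc zero))
  f4 = suc (suc (suc (suc zero)))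

module Minkowski (ℝ : Reals) where
  open Reals ℝ

  Vec4 : Set
  Vec4 = Fin 4 → Carrier

  t₀ x₁ x₂ x₃ : Fin 4
  t₀ = zero
  x₁ = suc zero
  x₂ = suc (suc zero)
  x₃ = suc (suc (suc zero))

  η : Vec4 → Vec4 → Carrier
  η u w = - (u t₀ * w t₀) + u x₁ * w x₁ + u x₂ * w x₂ + u x₃ * w x₃

  _⊖_ : Vec4 → Vec4 → Vec4
  (u ⊖ w) μ = u μ - w μ

  _⊕_ : Vec4 → Vec4 → Vec4
  (u ⊕ w) μ = u μ + w μ

  _·_ : Carrier → Vec4 → Vec4
  (a · u) μ = a * u μ

  _≋_ : Vec4 → Vec4 → Set
  u ≋ w = ∀ μ → u μ ≡ w μ

  IsZero : Vec4 → Set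
  IsZero u = ∀ μ → u μ ≡ 0#

  NullVector : Vec4 → Set
  NullVector n = ¬ IsZero n × η n n ≡ 0#

  -- future-pointing null vector (nonzero automatically since n⁰ > 0)
  FutureNull : Vec4 → Set
  FutureNull n = η n n ≡ 0# × 0# < n t₀

  AffinelyIndependent : (Fin 5 → Vec4) → Set
  AffinelyIndependent v =
    (c : Fin 4 → Carrier) →
    IsZero ((c zero · (v (suc zero) ⊖ v zero)) ⊕
           ((c (suc zero) · (v (suc (suc zero)) ⊖ v zero)) ⊕
           ((c (suc (suc zero)) · (v (suc (suc (suc zero))) ⊖ v zero)) ⊕
            (c (suc (suc (suc zero))) · (v (suc (suc (suc (suc zero)))) ⊖ v zero))))) →
    ∀ k → c k ≡ 0#

  hyperface : (Fin 5 → Vec4) → Fin 5 → (Fin 4 → Vec4)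
  hyperface v i j = v (punchIn i j)

  NormalToHyperface : (Fin 5 → Vec4) → Fin 5 → Vec4 → Set
  NormalToHyperface v i n = ∀ j k → η n (hyperface v i j ⊖ hyperface v i k) ≡ 0#

  NullFaced4Simplex : (Fin 5 → Vec4) → Set
  NullFaced4Simplex v =
    AffinelyIndependent v × (∀ i → Σ Vec4 λ n → NullVector n × NormalToHyperface v i n)

  -- Hyperface i is past if the simplex lies to the causal future of its
  -- null hyperplane {x | η(n, x - p) = 0} (n future-pointing null normal),
  -- the causal future being {x | η(n, x - p) ≤ 0}; the simplex is on that
  -- side iff the remaining vertex v i has η(n, v i - p) < 0.
  PastHyperface : (Fin 5 → Vec4) → Fin 5 → Set
  PastHyperface v i = Σ Vec4 λ n → FutureNull n × NormalToHyperface v i n ×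
    (∀ j → η n (v i ⊖ hyperface v i j) < 0#)

  FutureHyperface : (Fin 5 → Vec4) → Fin 5 → Set
  FutureHyperface v i = Σ Vec4 λ n → FutureNull n × NormalToHyperface v i n ×
    (∀ j → 0# < η n (v i ⊖ hyperface v i j))

  NormalToTet : (Fin 4 → Vec4) → Vec4 → Set
  NormalToTet t n = ∀ j k → η n (t j ⊖ t k) ≡ 0#

  -- Within the null hyperplane (spanned by the face directions and the null
  -- generator direction n), write  t k = q0 + α(q1 - q0) + β(q2 - q0) + γ n.
  -- The tetrahedron lies on the +n side of the face iff γ > 0, in which case
  -- the outgoing generator direction at the face is -n (past-pointing):
  -- the face is a past face iff γ > 0, a future face iff γ < 0.
  FaceDecomp : (Fin 4 → Vec4) → Fin 4 → Vec4 → Carrier → Set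
  FaceDecomp t k n γ = Σ Carrier λ α → Σ Carrier λ β →
    t k ≋ (q zero ⊕ ((α · (q (suc zero) ⊖ q zero)) ⊕
                    ((β · (q (suc (suc zero)) ⊖ q zero)) ⊕ (γ · n))))
    where
    q : Fin 3 → Vec4
    q j = t (punchIn k j)

  PastFace : (Fin 4 → Vec4) → Fin 4 → Set
  PastFace t k = Σ Vec4 λ n → FutureNull n × NormalToTet t n ×
    Σ Carrier λ γ → 0# < γ × FaceDecomp t k n γ

  FutureFace : (Fin 4 → Vec4) → Fin 4 → Set
  FutureFace t k = Σ Vec4 λ n → FutureNull n × NormalToTet t n ×
    Σ Carrier λ γ → γ < 0# × FaceDecomp t k n γ

  TetType : (Fin 4 → Vec4) → ℕ → ℕ → Set
  TetType t m n = Count (PastFace t) (allFin 4) m × Count (FutureFace t) (allFin 4) n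

  PastPast PastFuture FutureFuture : (Fin 5 → Vec4) → Fin 5 × Fin 5 → Set
  PastPast v (i , j) = PastHyperface v i × PastHyperface v j
  PastFuture v (i , j) = (PastHyperface v i × FutureHyperface v j)
                       ⊎ (FutureHyperface v i × PastHyperface v j)
  FutureFuture v (i , j) = FutureHyperface v i × FutureHyperface v j

  TwoPastThreeFuture : (Fin 5 → Vec4) → Set
  TwoPastThreeFuture v =
    Count (PastHyperface v) (allFin 5) 2 ×
    Count (FutureHyperface v) (allFin 5) 3 ×
    (∀ i → PastHyperface v i → TetType (hyperface v i) 1 3) ×
    (∀ i → FutureHyperface v i → TetType (hyperface v i) 2 2) ×
    Count (PastPast v) twoFaces 1 ×
    Count (PastFuture v) twoFaces 6 ×
    Count (FutureFuture v) twoFaces 3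

  TwoFutureThreePast : (Fin 5 → Vec4) → Set
  TwoFutureThreePast v =
    Count (FutureHyperface v) (allFin 5) 2 ×
    Count (PastHyperface v) (allFin 5) 3 ×
    (∀ i → FutureHyperface v i → TetType (hyperface v i) 3 1) ×
    (∀ i → PastHyperface v i → TetType (hyperface v i) 2 2) ×
    Count (FutureFuture v) twoFaces 1 ×
    Count (PastFuture v) twoFaces 6 ×
    Count (PastPast v) twoFaces 3

module Submission where

-- Choose future-pointing null normals N i of the five hyperfaces and let h i be the
-- height η (N i) (v i - p) of the apex v i over the opposite hyperface; h i ≠ 0 by affine
-- independence, and hyperface i is past or future according as h i < 0 or h i > 0.
-- The covector Σ N i / h i vanishes on every edge of the simplex, hence is zero.  Pairing it
-- with N a, and using that distinct future null normals pair strictly negatively, shows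
-- that the four signs of h j, j ≠ a, never all agree; hence there are two or three past
-- hyperfaces.  A face of the tetrahedron i is also a face of another hyperface k, and its
-- past/future type is the sign of h k.  The counts then follow by inspecting the
-- admissible sign patterns.

open import Defs hiding (yes; no)
open import Data.Nat as ℕ using (ℕ; zero; suc)
import Data.Nat.Properties as ℕ
open import Data.Integer as ℤ using (ℤ; -[1+_]; 0ℤ)
import Data.Integer.Properties as ℤ
open import Data.Fin using (Fin; zero; suc; punchIn; punchOut)
import Data.Fin.Properties as Fin
open import Data.Fin.Patterns using (0F; 1F; 2F; 3F; 4F)
import Data.Vec.Functional as V
open import Function using (_∘_; id)
open import Data.List using (List; []; _∷_; allFin; tabulate)
open import Data.Maybe using (Maybe; just; nothing)
open import Data.Product using (Σ; ∃; _,_; proj₁; proj₂; _×_)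
open import Data.Sum as Sum using (_⊎_; inj₁; inj₂)
open import Data.Empty using (⊥-elim)
open import Relation.Nullary using (¬_; yes; no; does; proof)
open import Relation.Nullary.Reflects using (Reflects; ofʸ; ofⁿ; _×-reflects_; _⊎-reflects_)
open import Data.Bool using (Bool; true; false; not; _∧_; _∨_; if_then_else_)
import Data.Bool.Properties as Bool
open import Relation.Binary.PropositionalEquality
open import Relation.Binary.Structures using (IsStrictTotalOrder)
open import Relation.Binary.Definitions using (tri<; tri≈; tri>)
open import Algebra.Bundles using (CommutativeRing)
open import Algebra.Structures using (IsCommutativeRing)
open import Algebra.Solver.Ring.AlmostCommutativeRing
  using (fromCommutativeRing; _-Raw-AlmostCommutative⟶_)

punchIn-surjective : ∀ {n} (i j : Fin (suc n)) → ¬ j ≡ i → ∃ λ k → punchIn i k ≡ j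
punchIn-surjective i j j≢i = punchOut (j≢i ∘ sym) , Fin.punchIn-punchOut (j≢i ∘ sym)

third-index : ∀ {n} (i j : Fin (suc (suc (suc n)))) → ¬ j ≡ i → ∃ λ k → ¬ k ≡ i × ¬ k ≡ j
third-index i j j≢i with punchIn-surjective i j j≢i
... | j′ , refl = punchIn i (punchIn j′ zero) , Fin.punchInᵢ≢i i _ ,
                  Fin.punchInᵢ≢i j′ zero ∘ Fin.punchIn-injective i _ j′

module IntegerCoefficientSolver
  {A : Set} {add mul : A → A → A} {neg : A → A} {0r 1r : A}
  (isCommutativeRing : IsCommutativeRing _≡_ add mul neg 0r 1r) where

  commutativeRing : CommutativeRing _ _
  commutativeRing = record { isCommutativeRing = isCommutativeRing }

  open CommutativeRing commutativeRing
    using (_+_; _*_; -_; 0#; 1#; ring; semiring; +-comm; +-assoc; +-identityˡ; +-identityʳ; -‿inverseʳ)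
  open import Algebra.Properties.Ring ring
    using (-0#≈0#; -‿involutive; -‿+-comm; -‿distribˡ-*; -‿distribʳ-*)
  open import Algebra.Properties.Semiring.Mult semiring
    using (×-homo-+; ×1-homo-*) renaming (_×_ to _×ᴿ_)

  ⟦_⟧ᶻ : ℤ → A
  ⟦ ℤ.+ n ⟧ᶻ = n ×ᴿ 1#
  ⟦ -[1+ n ] ⟧ᶻ = - (suc n ×ᴿ 1#)

  ⊖-homo : ∀ m n → ⟦ m ℤ.⊖ n ⟧ᶻ ≡ m ×ᴿ 1# + - (n ×ᴿ 1#)
  ⊖-homo zero zero = sym (trans (cong (0# +_) -0#≈0#) (+-identityˡ 0#))
  ⊖-homo zero (suc n) = sym (+-identityˡ _)
  ⊖-homo (suc m) zero = sym (trans (cong (suc m ×ᴿ 1# +_) -0#≈0#) (+-identityʳ _))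
  ⊖-homo (suc m) (suc n) = begin
    ⟦ suc m ℤ.⊖ suc n ⟧ᶻ                    ≡⟨ cong ⟦_⟧ᶻ (ℤ.[1+m]⊖[1+n]≡m⊖n m n) ⟩
    ⟦ m ℤ.⊖ n ⟧ᶻ                            ≡⟨ ⊖-homo m n ⟩
    x + - y                                ≡⟨ sym (cancel x y) ⟩
    (1# + x) + - (1# + y) ∎
    where
    open ≡-Reasoning
    x = m ×ᴿ 1#
    y = n ×ᴿ 1#
    cancel : ∀ x y → (1# + x) + - (1# + y) ≡ x + - y
    cancel x y = begin
      (1# + x) + - (1# + y)      ≡⟨ cong ((1# + x) +_) (sym (-‿+-comm 1# y)) ⟩
      (1# + x) + (- 1# + - y)    ≡⟨ +-assoc 1# x _ ⟩
      1# + (x + (- 1# + - y))    ≡⟨ cong (1# +_) (sym (+-assoc x _ _)) ⟩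
      1# + ((x + - 1#) + - y)    ≡⟨ cong (λ z → 1# + (z + - y)) (+-comm x _) ⟩
      1# + ((- 1# + x) + - y)    ≡⟨ cong (1# +_) (+-assoc _ x _) ⟩
      1# + (- 1# + (x + - y))    ≡⟨ sym (+-assoc 1# _ _) ⟩
      (1# + - 1#) + (x + - y)    ≡⟨ cong (_+ (x + - y)) (-‿inverseʳ 1#) ⟩
      0# + (x + - y)             ≡⟨ +-identityˡ _ ⟩
      x + - y ∎

  +-homo : ∀ i j → ⟦ i ℤ.+ j ⟧ᶻ ≡ ⟦ i ⟧ᶻ + ⟦ j ⟧ᶻ
  +-homo (ℤ.+ m) (ℤ.+ n) = ×-homo-+ 1# m n
  +-homo (ℤ.+ m) -[1+ n ] = ⊖-homo m (suc n)
  +-homo -[1+ m ] (ℤ.+ n) = trans (⊖-homo n (suc m)) (+-comm _ _)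
  +-homo -[1+ m ] -[1+ n ] = begin
    - (suc (suc (m ℕ.+ n)) ×ᴿ 1#)    ≡⟨ cong (λ k → - (suc k ×ᴿ 1#)) (sym (ℕ.+-suc m n)) ⟩
    - ((suc m ℕ.+ suc n) ×ᴿ 1#)      ≡⟨ cong -_ (×-homo-+ 1# (suc m) (suc n)) ⟩
    - (suc m ×ᴿ 1# + suc n ×ᴿ 1#)     ≡⟨ sym (-‿+-comm _ _) ⟩
    - (suc m ×ᴿ 1#) + - (suc n ×ᴿ 1#) ∎
    where open ≡-Reasoning

  -‿homo : ∀ i → ⟦ ℤ.- i ⟧ᶻ ≡ - ⟦ i ⟧ᶻ
  -‿homo (ℤ.+ zero) = sym -0#≈0#
  -‿homo (ℤ.+ suc n) = refl
  -‿homo -[1+ n ] = sym (-‿involutive _)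

  +*-homo : ∀ m j → ⟦ ℤ.+ m ℤ.* j ⟧ᶻ ≡ ⟦ ℤ.+ m ⟧ᶻ * ⟦ j ⟧ᶻ
  +*-homo m (ℤ.+ n) = trans (cong ⟦_⟧ᶻ (sym (ℤ.pos-* m n))) (×1-homo-* m n)
  +*-homo m -[1+ n ] = begin
    ⟦ ℤ.+ m ℤ.* ℤ.- ℤ.+ suc n ⟧ᶻ      ≡⟨ cong ⟦_⟧ᶻ (sym (ℤ.neg-distribʳ-* (ℤ.+ m) (ℤ.+ suc n))) ⟩
    ⟦ ℤ.- (ℤ.+ m ℤ.* ℤ.+ suc n) ⟧ᶻ    ≡⟨ -‿homo (ℤ.+ m ℤ.* ℤ.+ suc n) ⟩
    - ⟦ ℤ.+ m ℤ.* ℤ.+ suc n ⟧ᶻ        ≡⟨ cong -_ (+*-homo m (ℤ.+ suc n)) ⟩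
    - (m ×ᴿ 1# * (suc n ×ᴿ 1#))        ≡⟨ -‿distribʳ-* _ _ ⟩
    m ×ᴿ 1# * - (suc n ×ᴿ 1#) ∎
    where open ≡-Reasoning

  *-homo : ∀ i j → ⟦ i ℤ.* j ⟧ᶻ ≡ ⟦ i ⟧ᶻ * ⟦ j ⟧ᶻ
  *-homo (ℤ.+ m) j = +*-homo m j
  *-homo -[1+ m ] j = begin
    ⟦ ℤ.- ℤ.+ suc m ℤ.* j ⟧ᶻ          ≡⟨ cong ⟦_⟧ᶻ (sym (ℤ.neg-distribˡ-* (ℤ.+ suc m) j)) ⟩
    ⟦ ℤ.- (ℤ.+ suc m ℤ.* j) ⟧ᶻ        ≡⟨ -‿homo (ℤ.+ suc m ℤ.* j) ⟩
    - ⟦ ℤ.+ suc m ℤ.* j ⟧ᶻ            ≡⟨ cong -_ (+*-homo (suc m) j) ⟩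
    - (suc m ×ᴿ 1# * ⟦ j ⟧ᶻ)           ≡⟨ -‿distribˡ-* _ _ ⟩
    - (suc m ×ᴿ 1#) * ⟦ j ⟧ᶻ ∎
    where open ≡-Reasoning

  homomorphism : ℤ.+-*-rawRing -Raw-AlmostCommutative⟶ fromCommutativeRing commutativeRing
  homomorphism = record
    { ⟦_⟧ = ⟦_⟧ᶻ ; +-homo = +-homo ; *-homo = *-homo ; -‿homo = -‿homo
    ; 0-homo = refl ; 1-homo = +-identityʳ 1# }

  coefficients≟ : ∀ i j → Maybe (⟦ i ⟧ᶻ ≡ ⟦ j ⟧ᶻ)
  coefficients≟ i j with i ℤ.≟ j
  ... | yes refl = just refl
  ... | no _ = nothing

  open import Algebra.Solver.Ring ℤ.+-*-rawRing (fromCommutativeRing commutativeRing) homomorphism coefficients≟ public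
    using (solve; _:=_; _:+_; _:-_; _:*_; :-_; con; Polynomial)

module OrderedField (ℝ : Reals) where

  open Reals ℝ public hiding (_-_)

  -- Reals._-_ has no fixity declaration; this definitionally equal copy has the usual one.
  infixl 6 _-_
  _-_ : Carrier → Carrier → Carrier
  x - y = x + - y

  open IntegerCoefficientSolver isCommutativeRing public using (commutativeRing)
  open CommutativeRing commutativeRing public
    using ( +-assoc; +-comm; *-assoc; *-comm; +-identityˡ; +-identityʳ
          ; *-identityˡ; *-identityʳ; zeroˡ; zeroʳ
          ; -‿inverseˡ; -‿inverseʳ; ring; semiring )
  open import Algebra.Properties.Ring ring public
    using (-‿involutive; -‿distribʳ-*)
  open IsStrictTotalOrder isStrictTotalOrder public
    using (compare; _≟_; _<?_) renaming (trans to <-trans; irrefl to <-irrefl′; asym to <-asym)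
  open IntegerCoefficientSolver isCommutativeRing public
    using (solve; _:=_; _:+_; _:-_; _:*_; :-_; con; Polynomial)
  open import Algebra.Properties.Semiring.Sum semiring public
    using (sum; sum-cong-≗; sum-remove; sum-replicate-zero; ∑-distrib-+; *-distribˡ-sum)

  <-irrefl : ∀ {x} → ¬ x < x
  <-irrefl = <-irrefl′ refl

  <⇒≢ : ∀ {x y} → x < y → ¬ x ≡ y
  <⇒≢ x<x refl = <-irrefl x<x

  ≤⇒≯ : ∀ {x y} → x ≤ y → ¬ y < x
  ≤⇒≯ (inj₁ x<y) = <-asym x<y
  ≤⇒≯ (inj₂ refl) = <-irrefl

  x-y≡0⇒x≡y : ∀ {x y} → x - y ≡ 0# → x ≡ y
  x-y≡0⇒x≡y {x} {y} e = begin
    x                ≡⟨ solve 2 (λ x y → x := (x :- y) :+ y) refl x y ⟩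
    (x - y) + y      ≡⟨ cong (_+ y) e ⟩
    0# + y           ≡⟨ +-identityˡ y ⟩
    y ∎
    where open ≡-Reasoning

  x+y≡0⇒y≡-x : ∀ {x y} → x + y ≡ 0# → y ≡ - x
  x+y≡0⇒y≡-x {x} {y} e = begin
    y                ≡⟨ solve 2 (λ x y → y := (x :+ y) :- x) refl x y ⟩
    (x + y) - x      ≡⟨ cong (λ z → z - x) e ⟩
    0# - x           ≡⟨ +-identityˡ (- x) ⟩
    - x ∎
    where open ≡-Reasoning

  neg⇒-pos : ∀ {x} → x < 0# → 0# < - x
  neg⇒-pos {x} x<0 = subst₂ _<_ (-‿inverseʳ x) (+-identityˡ (- x)) (+-mono-< (- x) x<0)

  pos⇒-neg : ∀ {x} → 0# < x → - x < 0#
  pos⇒-neg {x} 0<x = subst₂ _<_ (+-identityˡ (- x)) (-‿inverseʳ x) (+-mono-< (- x) 0<x)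

  -pos⇒neg : ∀ {x} → 0# < - x → x < 0#
  -pos⇒neg {x} 0<-x = subst (_< 0#) (-‿involutive x) (pos⇒-neg 0<-x)

  pos+pos : ∀ {x y} → 0# < x → 0# < y → 0# < x + y
  pos+pos {x} {y} 0<x 0<y = <-trans 0<y (subst (_< x + y) (+-identityˡ y) (+-mono-< y 0<x))

  neg+neg : ∀ {x y} → x < 0# → y < 0# → x + y < 0#
  neg+neg {x} {y} x<0 y<0 = <-trans (subst (x + y <_) (+-identityˡ y) (+-mono-< y x<0)) y<0

  pos+nonneg : ∀ {x y} → 0# < x → 0# ≤ y → 0# < x + y
  pos+nonneg 0<x (inj₁ 0<y) = pos+pos 0<x 0<y
  pos+nonneg {x} 0<x (inj₂ refl) = subst (0# <_) (sym (+-identityʳ x)) 0<x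

  nonneg+nonneg : ∀ {x y} → 0# ≤ x → 0# ≤ y → 0# ≤ x + y
  nonneg+nonneg (inj₁ 0<x) 0≤y = inj₁ (pos+nonneg 0<x 0≤y)
  nonneg+nonneg (inj₂ refl) 0≤y = subst (0# ≤_) (sym (+-identityˡ _)) 0≤y

  nonneg+nonneg≡0 : ∀ {x y} → 0# ≤ x → 0# ≤ y → x + y ≡ 0# → x ≡ 0# × y ≡ 0#
  nonneg+nonneg≡0 (inj₁ 0<x) 0≤y e = ⊥-elim (<⇒≢ (pos+nonneg 0<x 0≤y) (sym e))
  nonneg+nonneg≡0 (inj₂ refl) 0≤y e = refl , trans (sym (+-identityˡ _)) e

  pos*neg : ∀ {x y} → 0# < x → y < 0# → x * y < 0#
  pos*neg {x} {y} 0<x y<0 =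
    -pos⇒neg (subst (0# <_) (sym (-‿distribʳ-* x y)) (*-pos 0<x (neg⇒-pos y<0)))

  neg*pos : ∀ {x y} → x < 0# → 0# < y → x * y < 0#
  neg*pos {x} {y} x<0 0<y = subst (_< 0#) (*-comm y x) (pos*neg 0<y x<0)

  neg*neg : ∀ {x y} → x < 0# → y < 0# → 0# < x * y
  neg*neg {x} {y} x<0 y<0 =
    subst (0# <_) (solve 2 (λ x y → (:- x) :* (:- y) := x :* y) refl x y) (*-pos (neg⇒-pos x<0) (neg⇒-pos y<0))

  0<1 : 0# < 1#
  0<1 with compare 0# 1#
  ... | tri< 0<1 _ _ = 0<1
  ... | tri≈ _ 0≡1 _ = ⊥-elim (0≢1 0≡1)
  ... | tri> _ _ 1<0 = ⊥-elim (<-asym 1<0 (subst (0# <_) (*-identityˡ 1#) (neg*neg 1<0 1<0)))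

  x≢0⇒0<x² : ∀ {x} → ¬ x ≡ 0# → 0# < x * x
  x≢0⇒0<x² {x} x≢0 with compare x 0#
  ... | tri< x<0 _ _ = neg*neg x<0 x<0
  ... | tri≈ _ x≡0 _ = ⊥-elim (x≢0 x≡0)
  ... | tri> _ _ 0<x = *-pos 0<x 0<x

  0≤x² : ∀ x → 0# ≤ x * x
  0≤x² x with x ≟ 0#
  ... | yes refl = inj₂ (sym (zeroˡ 0#))
  ... | no x≢0 = inj₁ (x≢0⇒0<x² x≢0)

  x²≡0⇒x≡0 : ∀ {x} → x * x ≡ 0# → x ≡ 0#
  x²≡0⇒x≡0 {x} e with x ≟ 0#
  ... | yes x≡0 = x≡0
  ... | no x≢0 = ⊥-elim (<⇒≢ (x≢0⇒0<x² x≢0) (sym e))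

  _⁻¹⟨_⟩ : ∀ x → ¬ x ≡ 0# → Carrier
  x ⁻¹⟨ x≢0 ⟩ = proj₁ (inverse x x≢0)

  x*x⁻¹≡1 : ∀ x (x≢0 : ¬ x ≡ 0#) → x * x ⁻¹⟨ x≢0 ⟩ ≡ 1#
  x*x⁻¹≡1 x x≢0 = proj₂ (inverse x x≢0)

  x⁻¹*x≡1 : ∀ x (x≢0 : ¬ x ≡ 0#) → x ⁻¹⟨ x≢0 ⟩ * x ≡ 1#
  x⁻¹*x≡1 x x≢0 = trans (*-comm _ x) (x*x⁻¹≡1 x x≢0)

  x⁻¹*[y*x]≡y : ∀ x (x≢0 : ¬ x ≡ 0#) y → x ⁻¹⟨ x≢0 ⟩ * (y * x) ≡ y
  x⁻¹*[y*x]≡y x x≢0 y = begin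
    x ⁻¹⟨ x≢0 ⟩ * (y * x)    ≡⟨ solve 3 (λ r y x → r :* (y :* x) := y :* (x :* r)) refl (x ⁻¹⟨ x≢0 ⟩) y x ⟩
    y * (x * x ⁻¹⟨ x≢0 ⟩)    ≡⟨ cong (y *_) (x*x⁻¹≡1 x x≢0) ⟩
    y * 1#                   ≡⟨ *-identityʳ y ⟩
    y                        ∎
    where open ≡-Reasoning

  *-cancelˡ-≡0 : ∀ {x y} → ¬ x ≡ 0# → x * y ≡ 0# → y ≡ 0#
  *-cancelˡ-≡0 {x} {y} x≢0 e = begin
    y                        ≡⟨ sym (*-identityˡ y) ⟩
    1# * y                   ≡⟨ cong (_* y) (sym (x⁻¹*x≡1 x x≢0)) ⟩
    (x ⁻¹⟨ x≢0 ⟩ * x) * y    ≡⟨ *-assoc _ x y ⟩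
    x ⁻¹⟨ x≢0 ⟩ * (x * y)    ≡⟨ cong (x ⁻¹⟨ x≢0 ⟩ *_) e ⟩
    x ⁻¹⟨ x≢0 ⟩ * 0#         ≡⟨ zeroʳ _ ⟩
    0# ∎
    where open ≡-Reasoning

  *-cancelʳ-≡0 : ∀ {x y} → ¬ y ≡ 0# → x * y ≡ 0# → x ≡ 0#
  *-cancelʳ-≡0 {x} {y} y≢0 e = *-cancelˡ-≡0 y≢0 (trans (*-comm y x) e)

  x⁻¹≢0 : ∀ {x} (x≢0 : ¬ x ≡ 0#) → ¬ x ⁻¹⟨ x≢0 ⟩ ≡ 0#
  x⁻¹≢0 {x} x≢0 x⁻¹≡0 =
    0≢1 (trans (sym (zeroʳ x)) (subst (λ y → x * y ≡ 1#) x⁻¹≡0 (x*x⁻¹≡1 x x≢0)))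

  ⁻¹-pos : ∀ {x} (x≢0 : ¬ x ≡ 0#) → 0# < x → 0# < x ⁻¹⟨ x≢0 ⟩
  ⁻¹-pos {x} x≢0 0<x with compare (x ⁻¹⟨ x≢0 ⟩) 0#
  ... | tri< y<0 _ _ = ⊥-elim (<-asym 0<1 (subst (_< 0#) (x*x⁻¹≡1 x x≢0) (pos*neg 0<x y<0)))
  ... | tri≈ _ y≡0 _ = ⊥-elim (x⁻¹≢0 x≢0 y≡0)
  ... | tri> _ _ 0<y = 0<y

  ⁻¹-neg : ∀ {x} (x≢0 : ¬ x ≡ 0#) → x < 0# → x ⁻¹⟨ x≢0 ⟩ < 0#
  ⁻¹-neg {x} x≢0 x<0 with compare (x ⁻¹⟨ x≢0 ⟩) 0#
  ... | tri< y<0 _ _ = y<0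
  ... | tri≈ _ y≡0 _ = ⊥-elim (x⁻¹≢0 x≢0 y≡0)
  ... | tri> _ _ 0<y = ⊥-elim (<-asym 0<1 (subst (_< 0#) (x*x⁻¹≡1 x x≢0) (neg*pos x<0 0<y)))

  sum-pos : ∀ {n} (f : Fin (suc n) → Carrier) → (∀ j → 0# < f j) → 0# < sum f
  sum-pos {zero} f pos = subst (0# <_) (sym (+-identityʳ _)) (pos zero)
  sum-pos {suc n} f pos = pos+pos (pos zero) (sum-pos (λ j → f (suc j)) (λ j → pos (suc j)))

  sum-neg : ∀ {n} (f : Fin (suc n) → Carrier) → (∀ j → f j < 0#) → sum f < 0#
  sum-neg {zero} f neg = subst (_< 0#) (sym (+-identityʳ _)) (neg zero)
  sum-neg {suc n} f neg = neg+neg (neg zero) (sum-neg (λ j → f (suc j)) (λ j → neg (suc j)))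

  sum-zero : ∀ {n} (f : Fin n → Carrier) → (∀ j → f j ≡ 0#) → sum f ≡ 0#
  sum-zero {n} f z = trans (sum-cong-≗ z) (sum-replicate-zero n)

  sum-remove-zero : ∀ {n} (f : Fin (suc n) → Carrier) i → f i ≡ 0# → sum f ≡ sum (f ∘ punchIn i)
  sum-remove-zero f i fᵢ≡0 =
    trans (sum-remove {i = i} f) (trans (cong (_+ sum (f ∘ punchIn i)) fᵢ≡0) (+-identityˡ _))

  LinearlyDependent : ∀ {m n} → (Fin m → Fin n → Carrier) → Set
  LinearlyDependent {m} f = Σ (Fin m → Carrier) λ c →
    (∃ λ j → ¬ c j ≡ 0#) × (∀ μ → sum (λ j → c j * f j μ) ≡ 0#)

  1≢0 : ¬ 1# ≡ 0#
  1≢0 e = 0≢1 (sym e)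

  zero-vector-dependent : ∀ {m n} (f : Fin (suc m) → Fin n → Carrier) →
                          (∀ μ → f zero μ ≡ 0#) → LinearlyDependent f
  zero-vector-dependent f f₀≡0 = (1# V.∷ λ _ → 0#) , (zero , 1≢0) , λ μ → begin
    1# * f zero μ + sum (λ j → 0# * f (suc j) μ)
      ≡⟨ cong₂ _+_ (trans (*-identityˡ _) (f₀≡0 μ)) (sum-zero (λ j → 0# * f (suc j) μ) (λ j → zeroˡ _)) ⟩
    0# + 0#
      ≡⟨ +-identityˡ 0# ⟩
    0# ∎
    where open ≡-Reasoning

  eliminate : ∀ {m n} (f : Fin (suc m) → Fin (suc n) → Carrier) μ₀ → ¬ f zero μ₀ ≡ 0# →
              Fin m → Fin n → Carrier
  eliminate f μ₀ d≢0 j ν =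
    f (suc j) (punchIn μ₀ ν) - (f (suc j) μ₀ * f zero μ₀ ⁻¹⟨ d≢0 ⟩ * f zero (punchIn μ₀ ν))

  eliminate-dependent : ∀ {m n} (f : Fin (suc m) → Fin (suc n) → Carrier) μ₀ (d≢0 : ¬ f zero μ₀ ≡ 0#) →
                        LinearlyDependent (eliminate f μ₀ d≢0) → LinearlyDependent f
  eliminate-dependent f μ₀ d≢0 (c , (j , cⱼ≢0) , c·g≡0) = c′ , (suc j , cⱼ≢0) , c′·f≡0
    where
    d = f zero μ₀
    e = d ⁻¹⟨ d≢0 ⟩
    S = sum (λ j → c j * f (suc j) μ₀)
    c′ = - (S * e) V.∷ c
    c′·f≡0 : ∀ μ → - (S * e) * f zero μ + sum (λ j → c j * f (suc j) μ) ≡ 0#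
    c′·f≡0 μ with μ Fin.≟ μ₀
    ... | yes refl = begin
      - (S * e) * d + S    ≡⟨ solve 3 (λ S e d → :- (S :* e) :* d :+ S := S :- S :* (e :* d)) refl S e d ⟩
      S - (S * (e * d))    ≡⟨ cong (λ z → S - (S * z)) (x⁻¹*x≡1 d d≢0) ⟩
      S - (S * 1#)         ≡⟨ cong (λ z → S - z) (*-identityʳ S) ⟩
      S - S                ≡⟨ -‿inverseʳ S ⟩
      0# ∎
      where open ≡-Reasoning
    ... | no μ≢μ₀ with punchIn-surjective μ₀ μ μ≢μ₀
    ... | ν , refl = begin
      - (S * e) * f₀ + sum (λ j → c j * f (suc j) μ)
        ≡⟨ cong (- (S * e) * f₀ +_) (sum-cong-≗ (λ j → unfold (c j) (f (suc j) μ) (f (suc j) μ₀))) ⟩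
      - (S * e) * f₀ + sum (λ j → c j * g j + (e * f₀) * (c j * F j))
        ≡⟨ cong (- (S * e) * f₀ +_) (∑-distrib-+ (λ j → c j * g j) (λ j → (e * f₀) * (c j * F j))) ⟩
      - (S * e) * f₀ + (sum (λ j → c j * g j) + sum (λ j → (e * f₀) * (c j * F j)))
        ≡⟨ cong₂ (λ x y → - (S * e) * f₀ + (x + y)) (c·g≡0 ν) (sym (*-distribˡ-sum (e * f₀) (λ j → c j * F j))) ⟩
      - (S * e) * f₀ + (0# + (e * f₀) * S)
        ≡⟨ solve 3 (λ S e f₀ → :- (S :* e) :* f₀ :+ (con 0ℤ :+ (e :* f₀) :* S) := con 0ℤ) refl S e f₀ ⟩
      0# ∎
      where
      open ≡-Reasoning
      f₀ = f zero (punchIn μ₀ ν)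
      g = λ j → eliminate f μ₀ d≢0 j ν
      F = λ j → f (suc j) μ₀
      unfold : ∀ c x y → c * x ≡ c * (x - (y * e * f₀)) + (e * f₀) * (c * y)
      unfold c x y = solve 5 (λ c x y e f₀ → c :* x := c :* (x :- (y :* e) :* f₀) :+ (e :* f₀) :* (c :* y))
        refl c x y e f₀

  vectors-dependent : ∀ n (f : Fin (suc n) → Fin n → Carrier) → LinearlyDependent f
  vectors-dependent zero f = (λ _ → 1#) , (zero , 1≢0) , λ ()
  vectors-dependent (suc n) f with Fin.all? (λ μ → f zero μ ≟ 0#)
  ... | yes f₀≡0 = zero-vector-dependent f f₀≡0
  ... | no f₀≢0 with Fin.¬∀⟶∃¬ _ _ (λ μ → f zero μ ≟ 0#) f₀≢0
  ...   | μ₀ , d≢0 = eliminate-dependent f μ₀ d≢0 (vectors-dependent n (eliminate f μ₀ d≢0))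

count : ∀ {A : Set} → (A → Bool) → List A → ℕ
count f [] = 0
count f (x ∷ xs) = if f x then suc (count f xs) else count f xs

Count-reflects : ∀ {A : Set} {P : A → Set} {f} → (∀ x → Reflects (P x) (f x)) →
                 ∀ xs → Count P xs (count f xs)
Count-reflects r [] = nil
Count-reflects {f = f} r (x ∷ xs) with f x | r x
... | true  | ofʸ p  = Count.yes p (Count-reflects r xs)
... | false | ofⁿ ¬p = Count.no ¬p (Count-reflects r xs)

counted : ∀ {A : Set} {P : A → Set} {f xs n} → (∀ x → Reflects (P x) (f x)) →
          count f xs ≡ n → Count P xs n
counted {P = P} {xs = xs} r #f = subst (Count P xs) #f (Count-reflects r xs)

count-tabulate : ∀ {A : Set} {n} (f : A → Bool) (g : Fin n → A) → count f (tabulate g) ≡ count (f ∘ g) (allFin n)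
count-tabulate {n = zero} f g = refl
count-tabulate {n = suc n} f g
  rewrite count-tabulate f (g ∘ suc) | count-tabulate (f ∘ g) suc = refl

true⇒P : ∀ {P : Set} {b} → Reflects P b → b ≡ true → P
true⇒P (ofʸ p) refl = p

P⇒true : ∀ {P : Set} {b} → Reflects P b → P → b ≡ true
P⇒true (ofʸ _) _ = refl
P⇒true (ofⁿ ¬p) p = ⊥-elim (¬p p)

countFin : ∀ {n} → (Fin n → Bool) → ℕ
countFin {n} f = count f (allFin n)

countFin-remove : ∀ {n} (f : Fin (suc n) → Bool) i →
                 countFin f ≡ (if f i then suc (countFin (f ∘ punchIn i)) else countFin (f ∘ punchIn i))
countFin-remove f zero = cong (λ c → if f zero then suc c else c) (count-tabulate f suc)
countFin-remove {suc n} f (suc i)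
  rewrite count-tabulate f suc | countFin-remove (f ∘ suc) i | count-tabulate (f ∘ punchIn (suc i)) suc
  with f zero | f (suc i)
... | true  | true  = refl
... | true  | false = refl
... | false | true  = refl
... | false | false = refl

countFin-remove-true : ∀ {n m} (f : Fin (suc n) → Bool) i → f i ≡ true →
                       countFin f ≡ suc m → countFin (f ∘ punchIn i) ≡ m
countFin-remove-true f i fᵢ≡true #f rewrite countFin-remove f i | fᵢ≡true = ℕ.suc-injective #f

countFin-remove-false : ∀ {n m} (f : Fin (suc n) → Bool) i → f i ≡ false →
                        countFin f ≡ m → countFin (f ∘ punchIn i) ≡ m
countFin-remove-false f i fᵢ≡false #f rewrite countFin-remove f i | fᵢ≡false = #f

NoFourAlike : (Fin 5 → Bool) → Set
NoFourAlike σ = ∀ a b → ¬ (∀ j → σ (punchIn a j) ≡ b)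

bothᵇ mixedᵇ neitherᵇ : (Fin 5 → Bool) → Fin 5 × Fin 5 → Bool
bothᵇ σ (i , j) = σ i ∧ σ j
mixedᵇ σ (i , j) = (σ i ∧ not (σ j)) ∨ (not (σ i) ∧ σ j)
neitherᵇ σ (i , j) = not (σ i) ∧ not (σ j)

record SignCounts (σ : Fin 5 → Bool) (t f tt tf ff : ℕ) : Set where
  constructor signCounts
  field
    #true    : countFin σ ≡ t
    #false   : countFin (not ∘ σ) ≡ f
    #both    : count (bothᵇ σ) twoFaces ≡ tt
    #mixed   : count (mixedᵇ σ) twoFaces ≡ tf
    #neither : count (neitherᵇ σ) twoFaces ≡ ff

all4 : ∀ {P : Fin 4 → Set} → P 0F → P 1F → P 2F → P 3F → ∀ j → P j
all4 p₀ p₁ p₂ p₃ 0F = p₀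
all4 p₀ p₁ p₂ p₃ 1F = p₁
all4 p₀ p₁ p₂ p₃ 2F = p₂
all4 p₀ p₁ p₂ p₃ 3F = p₃

two-or-three : ∀ b₀ b₁ b₂ b₃ b₄ → let σ = b₀ V.∷ b₁ V.∷ b₂ V.∷ b₃ V.∷ b₄ V.∷ V.[] in
               NoFourAlike σ → SignCounts σ 2 3 1 6 3 ⊎ SignCounts σ 3 2 3 6 1
two-or-three false false false false false nfa = ⊥-elim (nfa 0F false (all4 refl refl refl refl))
two-or-three false false false false true  nfa = ⊥-elim (nfa 4F false (all4 refl refl refl refl))
two-or-three false false false true  false nfa = ⊥-elim (nfa 3F false (all4 refl refl refl refl))
two-or-three false false false true  true  _   = inj₁ (signCounts refl refl refl refl refl)
two-or-three false false true  false false nfa = ⊥-elim (nfa 2F false (all4 refl refl refl refl))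
two-or-three false false true  false true  _   = inj₁ (signCounts refl refl refl refl refl)
two-or-three false false true  true  false _   = inj₁ (signCounts refl refl refl refl refl)
two-or-three false false true  true  true  _   = inj₂ (signCounts refl refl refl refl refl)
two-or-three false true  false false false nfa = ⊥-elim (nfa 1F false (all4 refl refl refl refl))
two-or-three false true  false false true  _   = inj₁ (signCounts refl refl refl refl refl)
two-or-three false true  false true  false _   = inj₁ (signCounts refl refl refl refl refl)
two-or-three false true  false true  true  _   = inj₂ (signCounts refl refl refl refl refl)
two-or-three false true  true  false false _   = inj₁ (signCounts refl refl refl refl refl)
two-or-three false true  true  false true  _   = inj₂ (signCounts refl refl refl refl refl)
two-or-three false true  true  true  false _   = inj₂ (signCounts refl refl refl refl refl)
two-or-three false true  true  true  true  nfa = ⊥-elim (nfa 0F true (all4 refl refl refl refl))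
two-or-three true  false false false false nfa = ⊥-elim (nfa 0F false (all4 refl refl refl refl))
two-or-three true  false false false true  _   = inj₁ (signCounts refl refl refl refl refl)
two-or-three true  false false true  false _   = inj₁ (signCounts refl refl refl refl refl)
two-or-three true  false false true  true  _   = inj₂ (signCounts refl refl refl refl refl)
two-or-three true  false true  false false _   = inj₁ (signCounts refl refl refl refl refl)
two-or-three true  false true  false true  _   = inj₂ (signCounts refl refl refl refl refl)
two-or-three true  false true  true  false _   = inj₂ (signCounts refl refl refl refl refl)
two-or-three true  false true  true  true  nfa = ⊥-elim (nfa 1F true (all4 refl refl refl refl))
two-or-three true  true  false false false _   = inj₁ (signCounts refl refl refl refl refl)
two-or-three true  true  false false true  _   = inj₂ (signCounts refl refl refl refl refl)
two-or-three true  true  false true  false _   = inj₂ (signCounts refl refl refl refl refl)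
two-or-three true  true  false true  true  nfa = ⊥-elim (nfa 2F true (all4 refl refl refl refl))
two-or-three true  true  true  false false _   = inj₂ (signCounts refl refl refl refl refl)
two-or-three true  true  true  false true  nfa = ⊥-elim (nfa 3F true (all4 refl refl refl refl))
two-or-three true  true  true  true  false nfa = ⊥-elim (nfa 4F true (all4 refl refl refl refl))
two-or-three true  true  true  true  true  nfa = ⊥-elim (nfa 0F true (all4 refl refl refl refl))

module Spacetime (ℝ : Reals) where

  open OrderedField ℝ
  open Minkowski ℝ

  ‖_‖² : Vec4 → Carrier
  ‖ u ‖² = u t₀ * u t₀ + u x₁ * u x₁ + u x₂ * u x₂ + u x₃ * u x₃

  0≤‖‖² : ∀ u → 0# ≤ ‖ u ‖²
  0≤‖‖² u = nonneg+nonneg (nonneg+nonneg (nonneg+nonneg (0≤² t₀) (0≤² x₁)) (0≤² x₂)) (0≤² x₃)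
    where 0≤² = λ μ → 0≤x² (u μ)

  ‖‖²≡0⇒IsZero : ∀ u → ‖ u ‖² ≡ 0# → IsZero u
  ‖‖²≡0⇒IsZero u ‖u‖²≡0 = λ
    { 0F → x²≡0⇒x≡0 (proj₁ split₁)
    ; 1F → x²≡0⇒x≡0 (proj₂ split₁)
    ; 2F → x²≡0⇒x≡0 (proj₂ split₂)
    ; 3F → x²≡0⇒x≡0 (proj₂ split₃) }
    where
    0≤² = λ μ → 0≤x² (u μ)
    split₃ = nonneg+nonneg≡0 (nonneg+nonneg (nonneg+nonneg (0≤² t₀) (0≤² x₁)) (0≤² x₂)) (0≤² x₃) ‖u‖²≡0
    split₂ = nonneg+nonneg≡0 (nonneg+nonneg (0≤² t₀) (0≤² x₁)) (0≤² x₂) (proj₁ split₃)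
    split₁ = nonneg+nonneg≡0 (0≤² t₀) (0≤² x₁) (proj₁ split₂)

  ηₚ : ∀ {k} (a₀ a₁ a₂ a₃ b₀ b₁ b₂ b₃ : Polynomial k) → Polynomial k
  ηₚ a₀ a₁ a₂ a₃ b₀ b₁ b₂ b₃ = :- (a₀ :* b₀) :+ a₁ :* b₁ :+ a₂ :* b₂ :+ a₃ :* b₃

  η-sym : ∀ u w → η u w ≡ η w u
  η-sym u w = solve 8 (λ a₀ a₁ a₂ a₃ b₀ b₁ b₂ b₃ →
      ηₚ a₀ a₁ a₂ a₃ b₀ b₁ b₂ b₃ := ηₚ b₀ b₁ b₂ b₃ a₀ a₁ a₂ a₃) refl
    (u t₀) (u x₁) (u x₂) (u x₃) (w t₀) (w x₁) (w x₂) (w x₃)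

  η-⊕ʳ : ∀ n x y → η n (x ⊕ y) ≡ η n x + η n y
  η-⊕ʳ n x y = solve 12 (λ n₀ n₁ n₂ n₃ x₀ x₁ x₂ x₃ y₀ y₁ y₂ y₃ →
      ηₚ n₀ n₁ n₂ n₃ (x₀ :+ y₀) (x₁ :+ y₁) (x₂ :+ y₂) (x₃ :+ y₃)
        := ηₚ n₀ n₁ n₂ n₃ x₀ x₁ x₂ x₃ :+ ηₚ n₀ n₁ n₂ n₃ y₀ y₁ y₂ y₃) refl
    (n t₀) (n x₁) (n x₂) (n x₃) (x t₀) (x x₁) (x x₂) (x x₃) (y t₀) (y x₁) (y x₂) (y x₃)

  η-⊖ʳ : ∀ n x y → η n (x ⊖ y) ≡ η n x - η n y
  η-⊖ʳ n x y = solve 12 (λ n₀ n₁ n₂ n₃ x₀ x₁ x₂ x₃ y₀ y₁ y₂ y₃ →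
      ηₚ n₀ n₁ n₂ n₃ (x₀ :- y₀) (x₁ :- y₁) (x₂ :- y₂) (x₃ :- y₃)
        := ηₚ n₀ n₁ n₂ n₃ x₀ x₁ x₂ x₃ :- ηₚ n₀ n₁ n₂ n₃ y₀ y₁ y₂ y₃) refl
    (n t₀) (n x₁) (n x₂) (n x₃) (x t₀) (x x₁) (x x₂) (x x₃) (y t₀) (y x₁) (y x₂) (y x₃)

  η-·ʳ : ∀ n a x → η n (a · x) ≡ a * η n x
  η-·ʳ n a x = solve 9 (λ n₀ n₁ n₂ n₃ a x₀ x₁ x₂ x₃ →
      ηₚ n₀ n₁ n₂ n₃ (a :* x₀) (a :* x₁) (a :* x₂) (a :* x₃) := a :* ηₚ n₀ n₁ n₂ n₃ x₀ x₁ x₂ x₃) refl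
    (n t₀) (n x₁) (n x₂) (n x₃) a (x t₀) (x x₁) (x x₂) (x x₃)

  η-·ˡ : ∀ a n x → η (a · n) x ≡ a * η n x
  η-·ˡ a n x = trans (η-sym (a · n) x) (trans (η-·ʳ x a n) (cong (a *_) (η-sym x n)))

  η-⊖ˡ : ∀ x y n → η (x ⊖ y) n ≡ η x n - η y n
  η-⊖ˡ x y n = trans (η-sym (x ⊖ y) n) (trans (η-⊖ʳ n x y) (cong₂ _-_ (η-sym n x) (η-sym n y)))

  η-zeroʳ : ∀ n → η n (λ _ → 0#) ≡ 0#
  η-zeroʳ n = solve 4 (λ n₀ n₁ n₂ n₃ →
      ηₚ n₀ n₁ n₂ n₃ (con 0ℤ) (con 0ℤ) (con 0ℤ) (con 0ℤ) := con 0ℤ) refl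
    (n t₀) (n x₁) (n x₂) (n x₃)

  η-congʳ : ∀ n {x y} → x ≋ y → η n x ≡ η n y
  η-congʳ n x≋y rewrite x≋y t₀ | x≋y x₁ | x≋y x₂ | x≋y x₃ = refl

  η-congˡ : ∀ {m n} x → m ≋ n → η m x ≡ η n x
  η-congˡ x m≋n rewrite m≋n t₀ | m≋n x₁ | m≋n x₂ | m≋n x₃ = refl

  η-sumʳ : ∀ {k} n (h : Fin k → Vec4) → η n (λ μ → sum (λ j → h j μ)) ≡ sum (λ j → η n (h j))
  η-sumʳ {zero} n h = η-zeroʳ n
  η-sumʳ {suc k} n h =
    trans (η-⊕ʳ n (h zero) (λ μ → sum (λ j → h (suc j) μ))) (cong (η n (h zero) +_) (η-sumʳ n (h ∘ suc)))

  η-sumˡ : ∀ {k} (h : Fin k → Vec4) x → η (λ μ → sum (λ j → h j μ)) x ≡ sum (λ j → η (h j) x)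
  η-sumˡ h x =
    trans (η-sym (λ μ → sum (λ j → h j μ)) x) (trans (η-sumʳ x h) (sum-cong-≗ (λ j → η-sym x (h j))))

  reflectTime : Vec4 → Vec4
  reflectTime u zero = - u zero
  reflectTime u (suc μ) = u (suc μ)

  η-reflectTime : ∀ u → η u (reflectTime u) ≡ ‖ u ‖²
  η-reflectTime u = solve 4 (λ a b c d → ηₚ a b c d (:- a) b c d := a :* a :+ b :* b :+ c :* c :+ d :* d) refl
    (u t₀) (u x₁) (u x₂) (u x₃)

  ‖a₀b-b₀a‖² : ∀ a b → ‖ (a t₀ · b) ⊖ (b t₀ · a) ‖² ≡
    (a t₀ * a t₀) * η b b + (b t₀ * b t₀) * η a a - ((a t₀ * b t₀) * (η a b + η a b))
  ‖a₀b-b₀a‖² a b = solve 8 (λ a₀ a₁ a₂ a₃ b₀ b₁ b₂ b₃ →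
      let d = λ x y → a₀ :* x :- b₀ :* y in
      d b₀ a₀ :* d b₀ a₀ :+ d b₁ a₁ :* d b₁ a₁ :+ d b₂ a₂ :* d b₂ a₂ :+ d b₃ a₃ :* d b₃ a₃
        := (a₀ :* a₀) :* ηₚ b₀ b₁ b₂ b₃ b₀ b₁ b₂ b₃ :+ (b₀ :* b₀) :* ηₚ a₀ a₁ a₂ a₃ a₀ a₁ a₂ a₃
           :- (a₀ :* b₀) :* (ηₚ a₀ a₁ a₂ a₃ b₀ b₁ b₂ b₃ :+ ηₚ a₀ a₁ a₂ a₃ b₀ b₁ b₂ b₃)) refl
    (a t₀) (a x₁) (a x₂) (a x₃) (b t₀) (b x₁) (b x₂) (b x₃)

  ‖a₀b-b₀a‖²-null : ∀ a b → η a a ≡ 0# → η b b ≡ 0# →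
                    ‖ (a t₀ · b) ⊖ (b t₀ · a) ‖² ≡ - ((a t₀ * b t₀) * (η a b + η a b))
  ‖a₀b-b₀a‖²-null a b ηaa≡0 ηbb≡0 = begin
    ‖ (a t₀ · b) ⊖ (b t₀ · a) ‖²
      ≡⟨ ‖a₀b-b₀a‖² a b ⟩
    A * η b b + B * η a a - (P * (η a b + η a b))
      ≡⟨ cong₂ (λ x y → A * x + B * y - (P * (η a b + η a b))) ηbb≡0 ηaa≡0 ⟩
    A * 0# + B * 0# - (P * (η a b + η a b))
      ≡⟨ solve 4 (λ A B P e → A :* con 0ℤ :+ B :* con 0ℤ :- P :* e := :- (P :* e)) refl A B P (η a b + η a b) ⟩
    - (P * (η a b + η a b)) ∎
    where
    open ≡-Reasoning
    A = a t₀ * a t₀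
    B = b t₀ * b t₀
    P = a t₀ * b t₀

  module _ (a b : Vec4) (fa : FutureNull a) (fb : FutureNull b) where

    futureNull-η≤0 : η a b ≤ 0#
    futureNull-η≤0 with compare (η a b) 0#
    ... | tri< η<0 _ _ = inj₁ η<0
    ... | tri≈ _ η≡0 _ = inj₂ η≡0
    ... | tri> _ _ 0<η = ⊥-elim (≤⇒≯ (0≤‖‖² ((a t₀ · b) ⊖ (b t₀ · a))) ‖‖²<0)
      where
      ‖‖²<0 : ‖ (a t₀ · b) ⊖ (b t₀ · a) ‖² < 0#
      ‖‖²<0 = subst (_< 0#) (sym (‖a₀b-b₀a‖²-null a b (proj₁ fa) (proj₁ fb)))
        (pos⇒-neg (*-pos (*-pos (proj₂ fa) (proj₂ fb)) (pos+pos 0<η 0<η)))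

    futureNull-η≡0⇒parallel : η a b ≡ 0# → (a t₀ · b) ≋ (b t₀ · a)
    futureNull-η≡0⇒parallel η≡0 μ =
      x-y≡0⇒x≡y (‖‖²≡0⇒IsZero ((a t₀ · b) ⊖ (b t₀ · a)) ‖‖²≡0 μ)
      where
      ‖‖²≡0 : ‖ (a t₀ · b) ⊖ (b t₀ · a) ‖² ≡ 0#
      ‖‖²≡0 = begin
        ‖ (a t₀ · b) ⊖ (b t₀ · a) ‖²
          ≡⟨ ‖a₀b-b₀a‖²-null a b (proj₁ fa) (proj₁ fb) ⟩
        - ((a t₀ * b t₀) * (η a b + η a b))
          ≡⟨ cong (λ x → - ((a t₀ * b t₀) * (x + x))) η≡0 ⟩
        - ((a t₀ * b t₀) * (0# + 0#))
          ≡⟨ solve 1 (λ p → :- (p :* (con 0ℤ :+ con 0ℤ)) := con 0ℤ) refl (a t₀ * b t₀) ⟩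
        0# ∎
        where open ≡-Reasoning

  nullVector⇒t₀≢0 : ∀ {n} → NullVector n → ¬ n t₀ ≡ 0#
  nullVector⇒t₀≢0 {n} (n≢0 , ηnn≡0) n₀≡0 = n≢0 (‖‖²≡0⇒IsZero n ‖n‖²≡0)
    where
    ‖n‖²≡0 : ‖ n ‖² ≡ 0#
    ‖n‖²≡0 = begin
      ‖ n ‖²
        ≡⟨ solve 4 (λ a b c d → a :* a :+ b :* b :+ c :* c :+ d :* d
                                                     := ηₚ a b c d a b c d :+ (a :* a :+ a :* a)) refl (n t₀) (n x₁) (n x₂) (n x₃) ⟩
      η n n + (n t₀ * n t₀ + n t₀ * n t₀)
        ≡⟨ cong₂ (λ x y → x + (y * y + y * y)) ηnn≡0 n₀≡0 ⟩
      0# + (0# * 0# + 0# * 0#)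
        ≡⟨ solve 0 (con 0ℤ :+ (con 0ℤ :* con 0ℤ :+ con 0ℤ :* con 0ℤ) := con 0ℤ) refl ⟩
      0# ∎
      where open ≡-Reasoning

  η-·-null : ∀ c n → η n n ≡ 0# → η (c · n) (c · n) ≡ 0#
  η-·-null c n ηnn≡0 = begin
    η (c · n) (c · n)    ≡⟨ η-·ˡ c n (c · n) ⟩
    c * η n (c · n)      ≡⟨ cong (c *_) (η-·ʳ n c n) ⟩
    c * (c * η n n)      ≡⟨ cong (λ x → c * (c * x)) ηnn≡0 ⟩
    c * (c * 0#)         ≡⟨ solve 1 (λ c → c :* (c :* con 0ℤ) := con 0ℤ) refl c ⟩
    0# ∎
    where open ≡-Reasoning

  futurePointingMultiple : ∀ {n} → NullVector n → Σ Carrier λ c → FutureNull (c · n)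
  futurePointingMultiple {n} null with compare (n t₀) 0#
  ... | tri< n₀<0 _ _ = - 1# , η-·-null (- 1#) n (proj₂ null) , neg*neg (pos⇒-neg 0<1) n₀<0
  ... | tri≈ _ n₀≡0 _ = ⊥-elim (nullVector⇒t₀≢0 null n₀≡0)
  ... | tri> _ _ 0<n₀ = 1# , η-·-null 1# n (proj₂ null) , subst (0# <_) (sym (*-identityˡ _)) 0<n₀

module Simplex (ℝ : Reals) (v : Fin 5 → Minkowski.Vec4 ℝ) where

  open OrderedField ℝ
  open Minkowski ℝ
  open Spacetime ℝ

  -- A displacement within the affine hull of the vertices when sum b ≡ 0#.
  displacement : (Fin 5 → Carrier) → Vec4
  displacement b μ = sum (λ k → b k * v k μ)

  η-displacement : ∀ n b → η n (displacement b) ≡ sum (λ k → b k * η n (v k))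
  η-displacement n b = trans (η-sumʳ n (λ k → b k · v k)) (sum-cong-≗ (λ k → η-·ʳ n (b k) (v k)))

  normalToHyperface-· : ∀ {i} c n → NormalToHyperface v i n → NormalToHyperface v i (c · n)
  normalToHyperface-· {i} c n n⊥ j k =
    trans (η-·ˡ c n (hyperface v i j ⊖ hyperface v i k)) (trans (cong (c *_) (n⊥ j k)) (zeroʳ c))

  module HyperfaceNormal {i : Fin 5} {n : Vec4} (n⊥ : NormalToHyperface v i n) where

    η-face : ∀ j → η n (v (punchIn i j)) ≡ η n (v (punchIn i zero))
    η-face j = x-y≡0⇒x≡y (trans (sym (η-⊖ʳ n (v (punchIn i j)) (v (punchIn i zero)))) (n⊥ j zero))

    height : Carrier
    height = η n (v i ⊖ hyperface v i zero)

    η-within : ∀ {j k} → ¬ j ≡ i → ¬ k ≡ i → η n (v j ⊖ v k) ≡ 0#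
    η-within {j} {k} j≢i k≢i with punchIn-surjective i j j≢i | punchIn-surjective i k k≢i
    ... | j′ , refl | k′ , refl = n⊥ j′ k′

    η-apex : ∀ {k} → ¬ k ≡ i → η n (v i ⊖ v k) ≡ height
    η-apex {k} k≢i with punchIn-surjective i k k≢i
    ... | k′ , refl = begin
      η n (v i ⊖ v (punchIn i k′))                 ≡⟨ η-⊖ʳ n (v i) (v (punchIn i k′)) ⟩
      η n (v i) - η n (v (punchIn i k′))           ≡⟨ cong (λ x → η n (v i) - x) (η-face k′) ⟩
      η n (v i) - η n (v (punchIn i zero))         ≡⟨ sym (η-⊖ʳ n (v i) (v (punchIn i zero))) ⟩
      height ∎
      where open ≡-Reasoning

    η-displacement-normal : ∀ b → sum b ≡ 0# → η n (displacement b) ≡ b i * height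
    η-displacement-normal b Σb≡0 = begin
      η n (displacement b)
        ≡⟨ η-displacement n b ⟩
      sum (λ k → b k * η n (v k))
        ≡⟨ sum-remove {i = i} (λ k → b k * η n (v k)) ⟩
      b i * η n (v i) + sum (λ j → b (punchIn i j) * η n (v (punchIn i j)))
        ≡⟨ cong (b i * η n (v i) +_) (sum-cong-≗ (λ j → trans (cong (b (punchIn i j) *_) (η-face j)) (*-comm _ c))) ⟩
      b i * η n (v i) + sum (λ j → c * b (punchIn i j))
        ≡⟨ cong (b i * η n (v i) +_) (sym (*-distribˡ-sum c (λ j → b (punchIn i j)))) ⟩
      b i * η n (v i) + c * sum (λ j → b (punchIn i j))
        ≡⟨ cong (λ x → b i * η n (v i) + c * x) Σrest≡-bᵢ ⟩
      b i * η n (v i) + c * - b i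
        ≡⟨ solve 3 (λ b a c → b :* a :+ c :* (:- b) := b :* (a :- c)) refl (b i) (η n (v i)) c ⟩
      b i * (η n (v i) - c)
        ≡⟨ cong (b i *_) (sym (η-⊖ʳ n (v i) (v (punchIn i zero)))) ⟩
      b i * height ∎
      where
      open ≡-Reasoning
      c = η n (v (punchIn i zero))
      Σrest≡-bᵢ : sum (λ j → b (punchIn i j)) ≡ - b i
      Σrest≡-bᵢ = x+y≡0⇒y≡-x (trans (sym (sum-remove {i = i} b)) Σb≡0)

  module _ (independent : AffinelyIndependent v) where

    edge : Fin 4 → Vec4
    edge j = v (suc j) ⊖ v zero

    edges-independent : ∀ c → (∀ μ → sum (λ j → c j * edge j μ) ≡ 0#) → ∀ j → c j ≡ 0#
    edges-independent c Σ≡0 = independent c nested≡0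
      where
      term : Fin 4 → Fin 4 → Carrier
      term j μ = c j * edge j μ
      nested≡0 : ∀ μ → term 0F μ + (term 1F μ + (term 2F μ + term 3F μ)) ≡ 0#
      nested≡0 μ = trans (cong (λ x → term 0F μ + (term 1F μ + (term 2F μ + x))) (sym (+-identityʳ _))) (Σ≡0 μ)

    edges-span : ∀ x → Σ (Fin 4 → Carrier) λ a → ∀ μ → x μ ≡ sum (λ j → a j * edge j μ)
    edges-span x with vectors-dependent 4 (x V.∷ edge)
    ... | c , (j , cⱼ≢0) , Σ≡0 with c zero ≟ 0#
    ...   | yes c₀≡0 = ⊥-elim (cⱼ≢0 (all-zero j))
      where
      all-zero : ∀ j → c j ≡ 0#
      all-zero zero = c₀≡0
      all-zero (suc j) = edges-independent (c ∘ suc) (λ μ → begin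
        sum (λ j → c (suc j) * edge j μ)
          ≡⟨ sym (+-identityˡ _) ⟩
        0# + sum (λ j → c (suc j) * edge j μ)
          ≡⟨ cong (_+ sum (λ j → c (suc j) * edge j μ)) (sym (trans (cong (_* x μ) c₀≡0) (zeroˡ (x μ)))) ⟩
        c zero * x μ + sum (λ j → c (suc j) * edge j μ)
          ≡⟨ Σ≡0 μ ⟩
        0# ∎) j
        where open ≡-Reasoning
    ...   | no c₀≢0 = (λ j → - (c (suc j) * e)) , λ μ → begin
      x μ
        ≡⟨ sym (*-identityˡ (x μ)) ⟩
      1# * x μ
        ≡⟨ cong (_* x μ) (sym (x⁻¹*x≡1 (c zero) c₀≢0)) ⟩
      (e * c zero) * x μ
        ≡⟨ solve 3 (λ e c x → (e :* c) :* x := :- e :* (:- (c :* x))) refl e (c zero) (x μ) ⟩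
      - e * - (c zero * x μ)
        ≡⟨ cong (- e *_) (sym (x+y≡0⇒y≡-x (Σ≡0 μ))) ⟩
      - e * sum (λ j → c (suc j) * edge j μ)
        ≡⟨ *-distribˡ-sum (- e) (λ j → c (suc j) * edge j μ) ⟩
      sum (λ j → - e * (c (suc j) * edge j μ))
        ≡⟨ sum-cong-≗ (λ j → solve 3 (λ e c E → :- e :* (c :* E) := :- (c :* e) :* E) refl e (c (suc j)) (edge j μ)) ⟩
      sum (λ j → - (c (suc j) * e) * edge j μ) ∎
      where
      open ≡-Reasoning
      e = c zero ⁻¹⟨ c₀≢0 ⟩

    displacements-span : ∀ x → Σ (Fin 5 → Carrier) λ b → sum b ≡ 0# × x ≋ displacement b
    displacements-span x = b , -‿inverseˡ (sum a) , x≋b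
      where
      a = proj₁ (edges-span x)
      b = - sum a V.∷ a
      x≋b : x ≋ displacement b
      x≋b μ = begin
        x μ
          ≡⟨ proj₂ (edges-span x) μ ⟩
        sum (λ j → a j * (v (suc j) μ - v zero μ))
          ≡⟨ sum-cong-≗ (λ j → solve 3 (λ a p q → a :* (p :- q) := a :* p :+ (:- q) :* a) refl (a j) (v (suc j) μ) (v zero μ)) ⟩
        sum (λ j → a j * v (suc j) μ + - v zero μ * a j)
          ≡⟨ ∑-distrib-+ (λ j → a j * v (suc j) μ) (λ j → - v zero μ * a j) ⟩
        sum (λ j → a j * v (suc j) μ) + sum (λ j → - v zero μ * a j)
          ≡⟨ cong (sum (λ j → a j * v (suc j) μ) +_) (sym (*-distribˡ-sum (- v zero μ) a)) ⟩
        sum (λ j → a j * v (suc j) μ) + - v zero μ * sum a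
          ≡⟨ solve 3 (λ T p A → T :+ (:- p) :* A := (:- A) :* p :+ T) refl _ (v zero μ) (sum a) ⟩
        displacement b μ ∎
        where open ≡-Reasoning

    annihilator-zero : ∀ w → (∀ b → sum b ≡ 0# → η w (displacement b) ≡ 0#) → IsZero w
    annihilator-zero w w⊥ = ‖‖²≡0⇒IsZero w (begin
      ‖ w ‖²                   ≡⟨ sym (η-reflectTime w) ⟩
      η w (reflectTime w)      ≡⟨ η-congʳ w (proj₂ (proj₂ span)) ⟩
      η w (displacement b)     ≡⟨ w⊥ b (proj₁ (proj₂ span)) ⟩
      0# ∎)
      where
      open ≡-Reasoning
      span = displacements-span (reflectTime w)
      b = proj₁ span

module NullFacedSimplex (ℝ : Reals) (v : Fin 5 → Minkowski.Vec4 ℝ)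
                        (nullFaced : Minkowski.NullFaced4Simplex ℝ v) where

  open OrderedField ℝ
  open Minkowski ℝ
  open Spacetime ℝ
  open Simplex ℝ v

  independent : AffinelyIndependent v
  independent = proj₁ nullFaced

  futureNormal : ∀ i → Σ Vec4 λ n → FutureNull n × NormalToHyperface v i n
  futureNormal i with proj₂ nullFaced i
  ... | n , null , n⊥ with futurePointingMultiple null
  ...   | c , future = c · n , future , normalToHyperface-· c n n⊥

  N : Fin 5 → Vec4
  N i = proj₁ (futureNormal i)

  N-future : ∀ i → FutureNull (N i)
  N-future i = proj₁ (proj₂ (futureNormal i))

  N⊥ : ∀ i → NormalToHyperface v i (N i)
  N⊥ i = proj₂ (proj₂ (futureNormal i))

  module Nᵢ (i : Fin 5) = HyperfaceNormal {i} {N i} (N⊥ i)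
  open Nᵢ using (height)

  height≢0 : ∀ i → ¬ height i ≡ 0#
  height≢0 i hᵢ≡0 = <⇒≢ (proj₂ (N-future i)) (sym (annihilator-zero independent (N i) N⊥disp t₀))
    where
    N⊥disp : ∀ b → sum b ≡ 0# → η (N i) (displacement b) ≡ 0#
    N⊥disp b Σb≡0 =
      trans (Nᵢ.η-displacement-normal i b Σb≡0) (trans (cong (b i *_) hᵢ≡0) (zeroʳ (b i)))

  normals-proportional : ∀ i n (n⊥ : NormalToHyperface v i n) →
                         (HyperfaceNormal.height {i} {n} n⊥ · N i) ≋ (height i · n)
  normals-proportional i n n⊥ μ = x-y≡0⇒x≡y (annihilator-zero independent w w⊥ μ)
    where
    module n = HyperfaceNormal {i} {n} n⊥
    h′ = n.height
    w = (h′ · N i) ⊖ (height i · n)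
    w⊥ : ∀ b → sum b ≡ 0# → η w (displacement b) ≡ 0#
    w⊥ b Σb≡0 = begin
      η w (displacement b)
        ≡⟨ η-⊖ˡ (h′ · N i) (height i · n) (displacement b) ⟩
      η (h′ · N i) (displacement b) - η (height i · n) (displacement b)
        ≡⟨ cong₂ _-_ (η-·ˡ h′ (N i) (displacement b)) (η-·ˡ (height i) n (displacement b)) ⟩
      h′ * η (N i) (displacement b) - height i * η n (displacement b)
        ≡⟨ cong₂ (λ x y → h′ * x - height i * y) (Nᵢ.η-displacement-normal i b Σb≡0) (n.η-displacement-normal b Σb≡0) ⟩
      h′ * (b i * height i) - height i * (b i * h′)
        ≡⟨ solve 3 (λ x y z → x :* (z :* y) :- y :* (z :* x) := con 0ℤ) refl h′ (height i) (b i) ⟩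
      0# ∎
      where open ≡-Reasoning

  past-hyperface : ∀ i → height i < 0# → PastHyperface v i
  past-hyperface i hᵢ<0 = N i , N-future i , N⊥ i , λ j →
    subst (_< 0#) (sym (Nᵢ.η-apex i (Fin.punchInᵢ≢i i j))) hᵢ<0

  future-hyperface : ∀ i → 0# < height i → FutureHyperface v i
  future-hyperface i 0<hᵢ = N i , N-future i , N⊥ i , λ j →
    subst (0# <_) (sym (Nᵢ.η-apex i (Fin.punchInᵢ≢i i j))) 0<hᵢ

  past-hyperface⇒height<0 : ∀ i → PastHyperface v i → height i < 0#
  past-hyperface⇒height<0 i (n , future , n⊥ , below) with compare (height i) 0#
  ... | tri< hᵢ<0 _ _ = hᵢ<0
  ... | tri≈ _ hᵢ≡0 _ = ⊥-elim (height≢0 i hᵢ≡0)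
  ... | tri> _ _ 0<hᵢ = ⊥-elim (<-asym (neg*pos (below zero) (proj₂ (N-future i)))
    (subst (0# <_) (sym (normals-proportional i n n⊥ t₀)) (*-pos 0<hᵢ (proj₂ future))))

  future-hyperface⇒0<height : ∀ i → FutureHyperface v i → 0# < height i
  future-hyperface⇒0<height i (n , future , n⊥ , above) with compare (height i) 0#
  ... | tri< hᵢ<0 _ _ = ⊥-elim (<-asym (*-pos (above zero) (proj₂ (N-future i)))
    (subst (_< 0#) (sym (normals-proportional i n n⊥ t₀)) (neg*pos hᵢ<0 (proj₂ future))))
  ... | tri≈ _ hᵢ≡0 _ = ⊥-elim (height≢0 i hᵢ≡0)
  ... | tri> _ _ 0<hᵢ = 0<hᵢ

  -- Were η (N i) (N j) zero, N j would be parallel to N i and would give height i = 0.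
  η-normals<0 : ∀ {i j} → ¬ i ≡ j → η (N i) (N j) < 0#
  η-normals<0 {i} {j} i≢j with futureNull-η≤0 (N i) (N j) (N-future i) (N-future j)
  ... | inj₁ η<0 = η<0
  ... | inj₂ η≡0 = ⊥-elim (height≢0 i (*-cancelˡ-≡0 Nⱼ₀≢0 (begin
    N j t₀ * height i
      ≡⟨ cong (N j t₀ *_) (sym (Nᵢ.η-apex i k≢i)) ⟩
    N j t₀ * η (N i) (v i ⊖ v k)
      ≡⟨ sym (η-·ˡ (N j t₀) (N i) (v i ⊖ v k)) ⟩
    η (N j t₀ · N i) (v i ⊖ v k)
      ≡⟨ η-congˡ (v i ⊖ v k) (sym ∘ futureNull-η≡0⇒parallel (N i) (N j) (N-future i) (N-future j) η≡0) ⟩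
    η (N i t₀ · N j) (v i ⊖ v k)
      ≡⟨ η-·ˡ (N i t₀) (N j) (v i ⊖ v k) ⟩
    N i t₀ * η (N j) (v i ⊖ v k)
      ≡⟨ cong (N i t₀ *_) (Nᵢ.η-within j i≢j k≢j) ⟩
    N i t₀ * 0#
      ≡⟨ zeroʳ _ ⟩
    0# ∎)))
    where
    open ≡-Reasoning
    Nⱼ₀≢0 = <⇒≢ (proj₂ (N-future j)) ∘ sym
    k≢i,k≢j = third-index j i i≢j
    k = proj₁ k≢i,k≢j
    k≢i = proj₂ (proj₂ k≢i,k≢j)
    k≢j = proj₁ (proj₂ k≢i,k≢j)

  height⁻¹ : Fin 5 → Carrier
  height⁻¹ k = height k ⁻¹⟨ height≢0 k ⟩

  -- Σₖ N k / height k annihilates every displacement, hence vanishes.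
  normals-relation : IsZero (λ μ → sum (λ k → height⁻¹ k * N k μ))
  normals-relation = annihilator-zero independent _ λ b Σb≡0 → begin
    η (λ μ → sum (λ k → height⁻¹ k * N k μ)) (displacement b)
      ≡⟨ η-sumˡ (λ k → height⁻¹ k · N k) (displacement b) ⟩
    sum (λ k → η (height⁻¹ k · N k) (displacement b))
      ≡⟨ sum-cong-≗ (λ k → η-·ˡ (height⁻¹ k) (N k) (displacement b)) ⟩
    sum (λ k → height⁻¹ k * η (N k) (displacement b))
      ≡⟨ sum-cong-≗ (λ k → cong (height⁻¹ k *_) (Nᵢ.η-displacement-normal k b Σb≡0)) ⟩
    sum (λ k → height⁻¹ k * (b k * height k))
      ≡⟨ sum-cong-≗ (λ k → x⁻¹*[y*x]≡y (height k) (height≢0 k) (b k)) ⟩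
    sum b
      ≡⟨ Σb≡0 ⟩
    0# ∎
    where open ≡-Reasoning

  relation-around : ∀ a → sum (λ j → height⁻¹ (punchIn a j) * η (N (punchIn a j)) (N a)) ≡ 0#
  relation-around a = begin
    sum (λ j → term (punchIn a j))
      ≡⟨ sym (+-identityˡ _) ⟩
    0# + sum (λ j → term (punchIn a j))
      ≡⟨ cong (_+ sum (λ j → term (punchIn a j))) (sym termₐ≡0) ⟩
    term a + sum (λ j → term (punchIn a j))
      ≡⟨ sym (sum-remove {i = a} term) ⟩
    sum term
      ≡⟨ sum-cong-≗ (λ k → sym (η-·ˡ (height⁻¹ k) (N k) (N a))) ⟩
    sum (λ k → η (height⁻¹ k · N k) (N a))
      ≡⟨ sym (η-sumˡ (λ k → height⁻¹ k · N k) (N a)) ⟩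
    η (λ μ → sum (λ k → height⁻¹ k * N k μ)) (N a)
      ≡⟨ η-congˡ (N a) normals-relation ⟩
    η (λ _ → 0#) (N a)
      ≡⟨ trans (η-sym (λ _ → 0#) (N a)) (η-zeroʳ (N a)) ⟩
    0# ∎
    where
    open ≡-Reasoning
    term : Fin 5 → Carrier
    term k = height⁻¹ k * η (N k) (N a)
    termₐ≡0 : term a ≡ 0#
    termₐ≡0 = trans (cong (height⁻¹ a *_) (proj₁ (N-future a))) (zeroʳ _)

  not-all-future-around : ∀ a → ¬ (∀ j → 0# < height (punchIn a j))
  not-all-future-around a 0<h = <⇒≢ (sum-neg _ λ j →
    pos*neg (⁻¹-pos (height≢0 _) (0<h j)) (η-normals<0 (Fin.punchInᵢ≢i a j))) (relation-around a)

  not-all-past-around : ∀ a → ¬ (∀ j → height (punchIn a j) < 0#)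
  not-all-past-around a h<0 = <⇒≢ (sum-pos _ λ j →
    neg*neg (⁻¹-neg (height≢0 _) (h<0 j)) (η-normals<0 (Fin.punchInᵢ≢i a j))) (sym (relation-around a))

  -- The k-th face of the tetrahedron i is also a face of hyperface apex, so the sign of γ in
  -- any FaceDecomp of it is opposite to the sign of height apex.
  module TetrahedronFace (i : Fin 5) (k : Fin 4) where

    apex : Fin 5
    apex = punchIn i k

    corner : Fin 3 → Fin 5
    corner z = punchIn i (punchIn k z)

    q : Fin 3 → Vec4
    q z = v (corner z)

    corner≢i : ∀ z → ¬ corner z ≡ i
    corner≢i z = Fin.punchInᵢ≢i i _

    corner≢apex : ∀ z → ¬ corner z ≡ apex
    corner≢apex z = Fin.punchInᵢ≢i k z ∘ Fin.punchIn-injective i _ k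

    apex≢i : ¬ apex ≡ i
    apex≢i = Fin.punchInᵢ≢i i k

    height-from-decomposition : ∀ n′ γ′ → FaceDecomp (hyperface v i) k n′ γ′ →
                                height apex ≡ γ′ * η (N apex) n′
    height-from-decomposition n′ γ′ (α , β , apex≋) = begin
      height apex
        ≡⟨ sym (Nᵢ.η-apex apex (corner≢apex 0F)) ⟩
      η (N apex) (v apex ⊖ q 0F)
        ≡⟨ η-congʳ (N apex) split ⟩
      η (N apex) ((α · X) ⊕ ((β · Y) ⊕ (γ′ · n′)))
        ≡⟨ η-⊕ʳ (N apex) (α · X) ((β · Y) ⊕ (γ′ · n′)) ⟩
      η (N apex) (α · X) + η (N apex) ((β · Y) ⊕ (γ′ · n′))
        ≡⟨ cong (η (N apex) (α · X) +_) (η-⊕ʳ (N apex) (β · Y) (γ′ · n′)) ⟩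
      η (N apex) (α · X) + (η (N apex) (β · Y) + η (N apex) (γ′ · n′))
        ≡⟨ cong₂ (λ x y → x + (y + η (N apex) (γ′ · n′))) (η-·ʳ (N apex) α X) (η-·ʳ (N apex) β Y) ⟩
      α * η (N apex) X + (β * η (N apex) Y + η (N apex) (γ′ · n′))
        ≡⟨ cong₂ (λ x y → α * x + (β * y + η (N apex) (γ′ · n′))) (side≡0 1F) (side≡0 2F) ⟩
      α * 0# + (β * 0# + η (N apex) (γ′ · n′))
        ≡⟨ solve 3 (λ a b x → a :* con 0ℤ :+ (b :* con 0ℤ :+ x) := x) refl α β _ ⟩
      η (N apex) (γ′ · n′)
        ≡⟨ η-·ʳ (N apex) γ′ n′ ⟩
      γ′ * η (N apex) n′ ∎
      where
      open ≡-Reasoning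
      X = q 1F ⊖ q 0F
      Y = q 2F ⊖ q 0F
      side≡0 : ∀ z → η (N apex) (q z ⊖ q 0F) ≡ 0#
      side≡0 z = Nᵢ.η-within apex (corner≢apex z) (corner≢apex 0F)
      split : (v apex ⊖ q 0F) ≋ ((α · X) ⊕ ((β · Y) ⊕ (γ′ · n′)))
      split μ = trans (cong (λ x → x - q 0F μ) (apex≋ μ))
        (solve 7 (λ q₀ q₁ q₂ a b g n → q₀ :+ (a :* (q₁ :- q₀) :+ (b :* (q₂ :- q₀) :+ g :* n)) :- q₀
                                         := a :* (q₁ :- q₀) :+ (b :* (q₂ :- q₀) :+ g :* n))
          refl (q 0F μ) (q 1F μ) (q 2F μ) α β γ′ (n′ μ))

    η-apex-i<0 : η (N apex) (N i) < 0#
    η-apex-i<0 = η-normals<0 apex≢i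

    γ : Carrier
    γ = height apex * η (N apex) (N i) ⁻¹⟨ <⇒≢ η-apex-i<0 ⟩

    -- γ is chosen so that both N i and N apex annihilate u; hence u is a displacement
    -- with vanishing coefficients at i and at apex, i.e. it lies along the face.
    u : Vec4
    u = (v apex ⊖ q 0F) ⊖ (γ · N i)

    η-u : ∀ n → η n u ≡ η n (v apex ⊖ q 0F) - γ * η n (N i)
    η-u n = trans (η-⊖ʳ n (v apex ⊖ q 0F) (γ · N i))
                  (cong (λ x → η n (v apex ⊖ q 0F) - x) (η-·ʳ n γ (N i)))

    span : Σ (Fin 5 → Carrier) λ b → sum b ≡ 0# × u ≋ displacement b
    span = displacements-span independent u

    b : Fin 5 → Carrier
    b = proj₁ span

    Σb≡0 : sum b ≡ 0#
    Σb≡0 = proj₁ (proj₂ span)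

    u≋b : u ≋ displacement b
    u≋b = proj₂ (proj₂ span)

    coefficient≡0 : ∀ j → η (N j) u ≡ 0# → b j ≡ 0#
    coefficient≡0 j η≡0 = *-cancelʳ-≡0 (height≢0 j)
      (trans (sym (Nᵢ.η-displacement-normal j b Σb≡0)) (trans (sym (η-congʳ (N j) u≋b)) η≡0))

    bᵢ≡0 : b i ≡ 0#
    bᵢ≡0 = coefficient≡0 i (begin
      η (N i) u
        ≡⟨ η-u (N i) ⟩
      η (N i) (v apex ⊖ q 0F) - γ * η (N i) (N i)
        ≡⟨ cong₂ (λ x y → x - γ * y) (Nᵢ.η-within i apex≢i (corner≢i 0F)) (proj₁ (N-future i)) ⟩
      0# - γ * 0#
        ≡⟨ solve 1 (λ g → con 0ℤ :- g :* con 0ℤ := con 0ℤ) refl γ ⟩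
      0# ∎)
      where open ≡-Reasoning

    bₐ≡0 : b apex ≡ 0#
    bₐ≡0 = coefficient≡0 apex (begin
      η (N apex) u
        ≡⟨ η-u (N apex) ⟩
      η (N apex) (v apex ⊖ q 0F) - γ * η (N apex) (N i)
        ≡⟨ cong₂ _-_ (Nᵢ.η-apex apex (corner≢apex 0F)) γη≡height ⟩
      height apex - height apex
        ≡⟨ -‿inverseʳ (height apex) ⟩
      0# ∎)
      where
      open ≡-Reasoning
      γη≡height : γ * η (N apex) (N i) ≡ height apex
      γη≡height = trans (*-assoc _ _ _)
        (trans (cong (height apex *_) (x⁻¹*x≡1 _ (<⇒≢ η-apex-i<0))) (*-identityʳ _))

    sum-over-face : ∀ (f : Fin 5 → Carrier) → f i ≡ 0# → f apex ≡ 0# → sum f ≡ sum (f ∘ corner)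
    sum-over-face f fᵢ≡0 fₐ≡0 =
      trans (sum-remove-zero f i fᵢ≡0) (sum-remove-zero (f ∘ punchIn i) k fₐ≡0)

    β : Fin 3 → Carrier
    β = b ∘ corner

    Σβ≡0 : β 0F + (β 1F + (β 2F + 0#)) ≡ 0#
    Σβ≡0 = trans (sym (sum-over-face b bᵢ≡0 bₐ≡0)) Σb≡0

    u≡Σβq : ∀ μ → u μ ≡ β 0F * q 0F μ + (β 1F * q 1F μ + (β 2F * q 2F μ + 0#))
    u≡Σβq μ = trans (u≋b μ) (sum-over-face (λ j → b j * v j μ) (vanish bᵢ≡0) (vanish bₐ≡0))
      where
      vanish : ∀ {j} → b j ≡ 0# → b j * v j μ ≡ 0#
      vanish bⱼ≡0 = trans (cong (_* _) bⱼ≡0) (zeroˡ _)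

    decomposition : FaceDecomp (hyperface v i) k (N i) γ
    decomposition = β 1F , β 2F , λ μ → begin
      v apex μ
        ≡⟨ solve 4 (λ t q g n → t := (t :- q :- g :* n) :+ q :+ g :* n) refl (v apex μ) (q 0F μ) γ (N i μ) ⟩
      u μ + q 0F μ + γ * N i μ
        ≡⟨ cong (λ x → x + q 0F μ + γ * N i μ) (u≡Σβq μ) ⟩
      β 0F * q 0F μ + (β 1F * q 1F μ + (β 2F * q 2F μ + 0#)) + q 0F μ + γ * N i μ
        ≡⟨ cong (λ x → x * q 0F μ + (β 1F * q 1F μ + (β 2F * q 2F μ + 0#)) + q 0F μ + γ * N i μ)
                (x+y≡0⇒y≡-x (trans (+-comm _ (β 0F)) Σβ≡0)) ⟩
      - (β 1F + (β 2F + 0#)) * q 0F μ + (β 1F * q 1F μ + (β 2F * q 2F μ + 0#)) + q 0F μ + γ * N i μ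
        ≡⟨ solve 7 (λ q₀ q₁ q₂ g n b₁ b₂ →
             :- (b₁ :+ (b₂ :+ con 0ℤ)) :* q₀ :+ (b₁ :* q₁ :+ (b₂ :* q₂ :+ con 0ℤ)) :+ q₀ :+ g :* n
               := q₀ :+ (b₁ :* (q₁ :- q₀) :+ (b₂ :* (q₂ :- q₀) :+ g :* n)))
             refl (q 0F μ) (q 1F μ) (q 2F μ) γ (N i μ) (β 1F) (β 2F) ⟩
      q 0F μ + (β 1F * (q 1F μ - q 0F μ) + (β 2F * (q 2F μ - q 0F μ) + γ * N i μ))  ∎
      where open ≡-Reasoning

    η-apex<0 : ∀ n′ γ′ → FutureNull n′ → FaceDecomp (hyperface v i) k n′ γ′ → η (N apex) n′ < 0#
    η-apex<0 n′ γ′ future dec with futureNull-η≤0 (N apex) n′ (N-future apex) future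
    ... | inj₁ η<0 = η<0
    ... | inj₂ η≡0 = ⊥-elim (height≢0 apex
      (trans (height-from-decomposition n′ γ′ dec) (trans (cong (γ′ *_) η≡0) (zeroʳ γ′))))

    past-face : height apex < 0# → PastFace (hyperface v i) k
    past-face h<0 = N i , N-future i , N⊥ i , γ , neg*neg h<0 (⁻¹-neg _ η-apex-i<0) , decomposition

    future-face : 0# < height apex → FutureFace (hyperface v i) k
    future-face 0<h = N i , N-future i , N⊥ i , γ , pos*neg 0<h (⁻¹-neg _ η-apex-i<0) , decomposition

    past-face⇒height<0 : PastFace (hyperface v i) k → height apex < 0#
    past-face⇒height<0 (n′ , future , _ , γ′ , 0<γ′ , dec) =
      subst (_< 0#) (sym (height-from-decomposition n′ γ′ dec)) (pos*neg 0<γ′ (η-apex<0 n′ γ′ future dec))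

    future-face⇒0<height : FutureFace (hyperface v i) k → 0# < height apex
    future-face⇒0<height (n′ , future , _ , γ′ , γ′<0 , dec) =
      subst (0# <_) (sym (height-from-decomposition n′ γ′ dec)) (neg*neg γ′<0 (η-apex<0 n′ γ′ future dec))

  isPast : Fin 5 → Bool
  isPast i = does (height i <? 0#)

  sign-reflects : ∀ {P Q : Set} i → (height i < 0# → P) → (P → height i < 0#) →
                  (0# < height i → Q) → (Q → 0# < height i) →
                  Reflects P (isPast i) × Reflects Q (not (isPast i))
  sign-reflects i h<0⇒P P⇒h<0 0<h⇒Q Q⇒0<h with isPast i | proof (height i <? 0#)
  ... | true  | ofʸ h<0 = ofʸ (h<0⇒P h<0) , ofⁿ (<-asym h<0 ∘ Q⇒0<h)
  ... | false | ofⁿ h≮0 = ofⁿ (h≮0 ∘ P⇒h<0) , ofʸ (0<h⇒Q 0<h)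
    where
    0<h : 0# < height i
    0<h with compare (height i) 0#
    ... | tri< h<0 _ _ = ⊥-elim (h≮0 h<0)
    ... | tri≈ _ h≡0 _ = ⊥-elim (height≢0 i h≡0)
    ... | tri> _ _ 0<h = 0<h

  hyperface-reflects : ∀ i → Reflects (PastHyperface v i) (isPast i) ×
                             Reflects (FutureHyperface v i) (not (isPast i))
  hyperface-reflects i = sign-reflects i (past-hyperface i) (past-hyperface⇒height<0 i)
                                         (future-hyperface i) (future-hyperface⇒0<height i)

  face-reflects : ∀ i k → Reflects (PastFace (hyperface v i) k) (isPast (punchIn i k)) ×
                          Reflects (FutureFace (hyperface v i) k) (not (isPast (punchIn i k)))
  face-reflects i k = sign-reflects (punchIn i k) past-face past-face⇒height<0 future-face future-face⇒0<height
    where open TetrahedronFace i k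

  height-reflects : ∀ i → Reflects (height i < 0#) (isPast i) × Reflects (0# < height i) (not (isPast i))
  height-reflects i = sign-reflects i id id id id

  isPast-noFourAlike : ∀ a b → ¬ (∀ j → isPast (punchIn a j) ≡ b)
  isPast-noFourAlike a true all-past =
    not-all-past-around a (λ j → true⇒P (proj₁ (height-reflects _)) (all-past j))
  isPast-noFourAlike a false all-future =
    not-all-future-around a (λ j → true⇒P (proj₂ (height-reflects _)) (cong not (all-future j)))

module Classification (ℝ : Reals) (v : Fin 5 → Minkowski.Vec4 ℝ)
                      (nullFaced : Minkowski.NullFaced4Simplex ℝ v) where

  open Minkowski ℝ
  open NullFacedSimplex ℝ v nullFaced public using (isPast)
  open NullFacedSimplex ℝ v nullFaced using (hyperface-reflects; face-reflects; isPast-noFourAlike)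

  -- isPast, tabulated so that its values compute on a concrete sign pattern.
  σ : Fin 5 → Bool
  σ = isPast 0F V.∷ isPast 1F V.∷ isPast 2F V.∷ isPast 3F V.∷ isPast 4F V.∷ V.[]

  σ≗isPast : ∀ i → σ i ≡ isPast i
  σ≗isPast 0F = refl
  σ≗isPast 1F = refl
  σ≗isPast 2F = refl
  σ≗isPast 3F = refl
  σ≗isPast 4F = refl

  σ-noFourAlike : NoFourAlike σ
  σ-noFourAlike a b all-b = isPast-noFourAlike a b (λ j → trans (sym (σ≗isPast (punchIn a j))) (all-b j))

  past-reflects : ∀ i → Reflects (PastHyperface v i) (σ i)
  past-reflects i =
    subst (Reflects (PastHyperface v i)) (sym (σ≗isPast i)) (proj₁ (hyperface-reflects i))

  future-reflects : ∀ i → Reflects (FutureHyperface v i) (not (σ i))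
  future-reflects i =
    subst (Reflects (FutureHyperface v i) ∘ not) (sym (σ≗isPast i)) (proj₂ (hyperface-reflects i))

  pastFace-reflects : ∀ i k → Reflects (PastFace (hyperface v i) k) (σ (punchIn i k))
  pastFace-reflects i k =
    subst (Reflects (PastFace (hyperface v i) k)) (sym (σ≗isPast (punchIn i k))) (proj₁ (face-reflects i k))

  futureFace-reflects : ∀ i k → Reflects (FutureFace (hyperface v i) k) (not (σ (punchIn i k)))
  futureFace-reflects i k =
    subst (Reflects (FutureFace (hyperface v i) k) ∘ not) (sym (σ≗isPast (punchIn i k))) (proj₂ (face-reflects i k))

  pastPast-reflects : ∀ f → Reflects (PastPast v f) (bothᵇ σ f)
  pastPast-reflects (i , j) = past-reflects i ×-reflects past-reflects j

  pastFuture-reflects : ∀ f → Reflects (PastFuture v f) (mixedᵇ σ f)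
  pastFuture-reflects (i , j) =
    (past-reflects i ×-reflects future-reflects j) ⊎-reflects (future-reflects i ×-reflects past-reflects j)

  futureFuture-reflects : ∀ f → Reflects (FutureFuture v f) (neitherᵇ σ f)
  futureFuture-reflects (i , j) = future-reflects i ×-reflects future-reflects j

  tetType : ∀ i {m n} → countFin (σ ∘ punchIn i) ≡ m → countFin (not ∘ σ ∘ punchIn i) ≡ n →
            TetType (hyperface v i) m n
  tetType i #past #future = counted (pastFace-reflects i) #past , counted (futureFace-reflects i) #future

  past⇒σ≡true : ∀ {i} → PastHyperface v i → σ i ≡ true
  past⇒σ≡true {i} = P⇒true (past-reflects i)

  future⇒σ≡false : ∀ {i} → FutureHyperface v i → σ i ≡ false
  future⇒σ≡false {i} = Bool.not-injective ∘ P⇒true (future-reflects i)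

  twoPastThreeFuture : SignCounts σ 2 3 1 6 3 → TwoPastThreeFuture v
  twoPastThreeFuture (signCounts #t #f #tt #tf #ff) =
    counted past-reflects #t , counted future-reflects #f ,
    (λ i past → tetType i (countFin-remove-true σ i (past⇒σ≡true past) #t)
                          (countFin-remove-false (not ∘ σ) i (cong not (past⇒σ≡true past)) #f)) ,
    (λ i future → tetType i (countFin-remove-false σ i (future⇒σ≡false future) #t)
                            (countFin-remove-true (not ∘ σ) i (cong not (future⇒σ≡false future)) #f)) ,
    counted pastPast-reflects #tt , counted pastFuture-reflects #tf , counted futureFuture-reflects #ff

  twoFutureThreePast : SignCounts σ 3 2 3 6 1 → TwoFutureThreePast v
  twoFutureThreePast (signCounts #t #f #tt #tf #ff) =
    counted future-reflects #f , counted past-reflects #t ,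
    (λ i future → tetType i (countFin-remove-false σ i (future⇒σ≡false future) #t)
                            (countFin-remove-true (not ∘ σ) i (cong not (future⇒σ≡false future)) #f)) ,
    (λ i past → tetType i (countFin-remove-true σ i (past⇒σ≡true past) #t)
                          (countFin-remove-false (not ∘ σ) i (cong not (past⇒σ≡true past)) #f)) ,
    counted futureFuture-reflects #ff , counted pastFuture-reflects #tf , counted pastPast-reflects #tt

mainTheorem2 : (ℝ : Reals) → (v : Fin 5 → Minkowski.Vec4 ℝ) → Minkowski.NullFaced4Simplex ℝ v → Minkowski.TwoPastThreeFuture ℝ v ⊎ Minkowski.TwoFutureThreePast ℝ v
mainTheorem2 ℝ v nullFaced =
  Sum.map twoPastThreeFuture twoFutureThreePast
    (two-or-three (isPast 0F) (isPast 1F) (isPast 2F) (isPast 3F) (isPast 4F) σ-noFourAlike)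
  where open Classification ℝ v nullFaced
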